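{- Fix a coloring $(f_0,f_1,f_2)$ of $D_3(m)$ and a color $c$. Let $P_0=\{v\in V:S(v)=0\}$ and $F_c=f_c^m|_{P_0}:P_0\to P_0$. Then the directed cycles of $f_c$ are in bijection with the directed cycles of $F_c$, and the length of a cycle of $f_c$ is $m$ times the length of the corresponding cycle of $F_c$. In particular, $f_c$ is a single cycle of length $m^3$ on $V$ if and only if $F_c$ is a single cycle of length $m^2$ on $P_0$.
   Context: Let $m\ge 3$, $V=(\mathbb Z_m)^3$, and $e_1,e_2,e_3$ the standard basis vectors; $D_3(m)$ is the digraph on $V$ with arcs $v\to v+e_1,v+e_2,v+e_3$ (mod $m$). A coloring is a triple $(f_0,f_1,f_2)$ of permutations of $V$ with $\{f_0(v),f_1(v),f_2(v)\}=\{v+e_1,v+e_2,v+e_3\}$ for all $v$. The layer function is $S(i,j,k)=i+j+k\pmod m$. -}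

module Defs where

open import Data.Nat using (ℕ; zero; suc; _+_; _*_; _%_; NonZero)
open import Data.Nat.Properties using (+-assoc; +-suc)
open import Data.Nat.DivMod using (_mod_; %-distribˡ-+; m%n%n≡m%n; [m+n]%n≡m%n)
open import Data.Fin using (Fin; toℕ)
open import Data.Fin.Properties using (toℕ-fromℕ<)
open import Data.Product using (Σ; ∃; _×_; _,_; proj₁; proj₂)
open import Function.Bundles using (_↔_; Inverse)
open import Relation.Binary.PropositionalEquality
  using (_≡_; _≢_; refl; sym; trans; cong)
open import Data.Nat using (_<_)

-- Z_m, V = (Z_m)^3 (m given with NonZero; the theorem assumes 3 ≤ m).
V : (m : ℕ) → Set
V m = Fin m × Fin m × Fin m

inc : {m : ℕ} .{{_ : NonZero m}} → Fin m → Fin m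
inc {m} x = suc (toℕ x) mod m

-- v ↦ v + e_j, colors / directions indexed by Fin 3 (j = 0,1,2 stands for e_1,e_2,e_3)
shift : {m : ℕ} .{{_ : NonZero m}} → Fin 3 → V m → V m
shift Fin.zero (i , j , k) = inc i , j , k
shift (Fin.suc Fin.zero) (i , j , k) = i , inc j , k
shift (Fin.suc (Fin.suc Fin.zero)) (i , j , k) = i , j , inc k

-- A coloring (f_0,f_1,f_2): permutations of V with {f_0 v, f_1 v, f_2 v} = {v+e_1, v+e_2, v+e_3}
-- (set equality written as mutual inclusion).
record Coloring (m : ℕ) .{{_ : NonZero m}} : Set where
  field
    f   : Fin 3 → V m ↔ V m
    arcs : ∀ v → (∀ c → ∃ λ j → Inverse.to (f c) v ≡ shift j v)
               × (∀ j → ∃ λ c → Inverse.to (f c) v ≡ shift j v)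

col : {m : ℕ} .{{_ : NonZero m}} → Coloring m → Fin 3 → V m → V m
col C c = Inverse.to (Coloring.f C c)

iter : {A : Set} → ℕ → (A → A) → A → A
iter zero g x = x
iter (suc n) g x = g (iter n g x)

S : {m : ℕ} .{{_ : NonZero m}} → V m → ℕ
S {m} (i , j , k) = (toℕ i + toℕ j + toℕ k) % m

P0 : (m : ℕ) .{{_ : NonZero m}} → Set
P0 m = Σ (V m) (λ v → S v ≡ 0)

private
  absorb : ∀ {m} .{{_ : NonZero m}} x y → (x % m + y) % m ≡ (x + y) % m
  absorb {m} x y = trans (%-distribˡ-+ (x % m) y m)
    (trans (cong (λ t → (t + y % m) % m) (m%n%n≡m%n x m)) (sym (%-distribˡ-+ x y m)))

  toℕ-inc : ∀ {m} .{{_ : NonZero m}} (x : Fin m) → toℕ (inc x) ≡ suc (toℕ x) % m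
  toℕ-inc {m} x = toℕ-fromℕ< _

  S-shift : ∀ {m} .{{_ : NonZero m}} j (v : V m) → S (shift j v) ≡ suc (toℕ (proj₁ v) + toℕ (proj₁ (proj₂ v)) + toℕ (proj₂ (proj₂ v))) % m
  S-shift {m} Fin.zero (i , j , k) =
    trans (cong (λ t → (t + toℕ j + toℕ k) % m) (toℕ-inc i))
    (trans (cong (_% m) (+-assoc (suc (toℕ i) % m) (toℕ j) (toℕ k)))
    (trans (absorb (suc (toℕ i)) (toℕ j + toℕ k))
      (cong (_% m) (sym (+-assoc (suc (toℕ i)) (toℕ j) (toℕ k))))))
  S-shift {m} (Fin.suc Fin.zero) (i , j , k) =
    trans (cong (λ t → (toℕ i + t + toℕ k) % m) (toℕ-inc j))
    (trans (cong (_% m) (+-assoc (toℕ i) (suc (toℕ j) % m) (toℕ k)))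
    (trans (%-distribˡ-+ (toℕ i) (suc (toℕ j) % m + toℕ k) m)
    (trans (cong (λ t → (toℕ i % m + t) % m) (absorb (suc (toℕ j)) (toℕ k)))
    (trans (sym (%-distribˡ-+ (toℕ i) (suc (toℕ j) + toℕ k) m))
      (cong (_% m) (trans (+-suc (toℕ i) (toℕ j + toℕ k))
        (cong suc (sym (+-assoc (toℕ i) (toℕ j) (toℕ k))))))))))
  S-shift {m} (Fin.suc (Fin.suc Fin.zero)) (i , j , k) =
    trans (cong (λ t → (toℕ i + toℕ j + t) % m) (toℕ-inc k))
    (trans (%-distribˡ-+ (toℕ i + toℕ j) (suc (toℕ k) % m) m)
    (trans (cong (λ t → ((toℕ i + toℕ j) % m + t) % m) (m%n%n≡m%n (suc (toℕ k)) m))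
    (trans (sym (%-distribˡ-+ (toℕ i + toℕ j) (suc (toℕ k)) m))
      (cong (_% m) (+-suc (toℕ i + toℕ j) (toℕ k))))))

  w : ∀ {m} → V m → ℕ
  w (i , j , k) = toℕ i + toℕ j + toℕ k

  S-col : ∀ {m} .{{_ : NonZero m}} (C : Coloring m) c v → S (col C c v) ≡ suc (w v) % m
  S-col C c v with proj₁ (Coloring.arcs C v) c
  ... | j , eq rewrite eq = S-shift j v

  S-iter : ∀ {m} .{{_ : NonZero m}} (C : Coloring m) c n v → S (iter n (col C c) v) ≡ (n + w v) % m
  S-iter C c zero v = refl
  S-iter {m} C c (suc n) v =
    trans (S-col C c (iter n (col C c) v))
    (trans (%-distribˡ-+ 1 (w (iter n (col C c) v)) m)
    (trans (cong (λ t → (1 % m + t) % m) (S-iter C c n v))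
    (sym (%-distribˡ-+ 1 (n + w v) m))))

  S-iter-m : ∀ {m} .{{_ : NonZero m}} (C : Coloring m) c v → S (iter m (col C c) v) ≡ S v
  S-iter-m {m} C c v = trans (S-iter C c m v)
    (trans (cong (_% m) (Data.Nat.Properties.+-comm m (w v))) ([m+n]%n≡m%n (w v) m))

Fmap : {m : ℕ} .{{_ : NonZero m}} → Coloring m → Fin 3 → P0 m → P0 m
Fmap {m} C c (v , s) = iter m (col C c) v , trans (S-iter-m C c v) s

SameCycle : {A : Set} → (A → A) → A → A → Set
SameCycle g u v = ∃ λ k → iter k g u ≡ v

CycleLength : {A : Set} → (A → A) → A → ℕ → Set
CycleLength g u L = 0 < L × iter L g u ≡ u × (∀ k → 0 < k → k < L → iter k g u ≢ u)

SingleCycle : {A : Set} → (A → A) → ℕ → Set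
SingleCycle {A} g N = (∀ (u v : A) → SameCycle g u v) × (∀ (u : A) → CycleLength g u N)

{-# OPTIONS --safe #-}
-- Every arc of D₃(m) raises the layer S by one modulo m. Hence an f_c-orbit
-- reaches P₀ within m steps from any point, and from a point of P₀ it is back in
-- P₀ exactly after multiples of m steps, which are the steps of F_c = f_c^m.
-- So each f_c-cycle meets P₀ in a single F_c-cycle, m times shorter; since f_c
-- is injective, the cycle length is the same at every point of an orbit.
module Submission where

open import Defs
open import Data.Nat using (ℕ; zero; suc; _+_; _*_; _^_; _≤_; _<_; _∸_; _%_; NonZero; >-nonZero; >-nonZero⁻¹)
open import Data.Nat.Properties using (+-comm; +-suc; +-identityʳ; *-comm; *-suc; *-zeroʳ; ≡-irrelevant; <⇒≤; m∸n+n≡m; m*n≢0⇒n≢0; m<n⇒m<o*n; *-monoʳ-<; *-cancelˡ-<)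
open import Data.Nat.DivMod using (%-distribˡ-+; m%n%n≡m%n; m<n⇒m%n≡m; n%n≡0; m%n<n)
open import Data.Nat.Divisibility using (_∣_; divides; m%n≡0⇒n∣m)
open import Data.Fin using (Fin; toℕ)
open import Data.Fin.Properties using (toℕ-fromℕ<)
open import Data.Product using (Σ; ∃; _×_; _,_; proj₁; proj₂)
open import Function.Bundles using (_⇔_; mk⇔; Equivalence; Injection)
open import Function.Definitions using (Injective)
open import Function.Properties.Inverse using (↔⇒↣)
open import Relation.Binary.PropositionalEquality
open ≡-Reasoning

m*n>0⇒n>0 : ∀ m {n} → 0 < m * n → 0 < n
m*n>0⇒n>0 m {n} mn>0 = >-nonZero⁻¹ n {{m*n≢0⇒n≢0 m {{>-nonZero mn>0}}}}

iter-semiconj : {A B : Set} {F : A → A} {h : B → B} (π : A → B) →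
                (∀ a → π (F a) ≡ h (π a)) → ∀ n a → π (iter n F a) ≡ iter n h (π a)
iter-semiconj         π commutes zero    a = refl
iter-semiconj {h = h} π commutes (suc n) a = trans (commutes _) (cong h (iter-semiconj π commutes n a))

iter-fixedPoint : {A : Set} (g : A → A) (n : ℕ) {x : A} → g x ≡ x → iter n g x ≡ x
iter-fixedPoint g zero    gx≡x = refl
iter-fixedPoint g (suc n) gx≡x = trans (cong g (iter-fixedPoint g n gx≡x)) gx≡x

module _ {A : Set} (g : A → A) where

  iter-+ : ∀ a b x → iter (a + b) g x ≡ iter a g (iter b g x)
  iter-+ zero    b x = refl
  iter-+ (suc a) b x = cong g (iter-+ a b x)

  iter-comm : ∀ a b x → iter a g (iter b g x) ≡ iter b g (iter a g x)
  iter-comm a b x = begin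
    iter a g (iter b g x) ≡⟨ iter-+ a b x ⟨
    iter (a + b) g x      ≡⟨ cong (λ n → iter n g x) (+-comm a b) ⟩
    iter (b + a) g x      ≡⟨ iter-+ b a x ⟩
    iter b g (iter a g x) ∎

  iter-* : ∀ m n x → iter (m * n) g x ≡ iter n (iter m g) x
  iter-* m zero    x = cong (λ k → iter k g x) (*-zeroʳ m)
  iter-* m (suc n) x = begin
    iter (m * suc n) g x        ≡⟨ cong (λ k → iter k g x) (*-suc m n) ⟩
    iter (m + m * n) g x        ≡⟨ iter-+ m (m * n) x ⟩
    iter m g (iter (m * n) g x) ≡⟨ cong (iter m g) (iter-* m n x) ⟩
    iter (suc n) (iter m g) x   ∎

  iter-injective : Injective _≡_ _≡_ g → ∀ n → Injective _≡_ _≡_ (iter n g)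
  iter-injective g-injective zero    eq = eq
  iter-injective g-injective (suc n) eq = iter-injective g-injective n (g-injective eq)

  SameCycle-trans : ∀ {x y z} → SameCycle g x y → SameCycle g y z → SameCycle g x z
  SameCycle-trans {x} (a , refl) (b , refl) = b + a , iter-+ b a x

  SameCycle-return : ∀ L {x} → 0 < L → iter L g x ≡ x → ∀ j → SameCycle g (iter j g x) x
  SameCycle-return (suc n) {x} _ period j = n * j , (begin
    iter (n * j) g (iter j g x) ≡⟨ iter-comm (n * j) j x ⟩
    iter j g (iter (n * j) g x) ≡⟨ iter-+ j (n * j) x ⟨
    iter (suc n * j) g x        ≡⟨ iter-* (suc n) j x ⟩
    iter j (iter (suc n) g) x   ≡⟨ iter-fixedPoint (iter (suc n) g) j period ⟩
    x                           ∎)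

  CycleLength-fromOrbit : Injective _≡_ _≡_ g → ∀ j {x L} →
                          CycleLength g (iter j g x) L → CycleLength g x L
  CycleLength-fromOrbit g-injective j {x} {L} (L>0 , period , minimal) =
      L>0
    , iter-injective g-injective j (trans (iter-comm j L x) period)
    , λ k k>0 k<L returns → minimal k k>0 k<L (trans (iter-comm k j x) (cong (iter j g) returns))

module _ {m : ℕ} .{{_ : NonZero m}} where

  %-cong-+ : ∀ {a a′ b b′} → a % m ≡ a′ % m → b % m ≡ b′ % m → (a + b) % m ≡ (a′ + b′) % m
  %-cong-+ {a} {a′} {b} {b′} a≡a′ b≡b′ = begin
    (a + b) % m             ≡⟨ %-distribˡ-+ a b m ⟩
    (a % m + b % m) % m     ≡⟨ cong₂ (λ s t → (s + t) % m) a≡a′ b≡b′ ⟩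
    (a′ % m + b′ % m) % m   ≡⟨ %-distribˡ-+ a′ b′ m ⟨
    (a′ + b′) % m           ∎

  suc-%-% : ∀ a → suc (a % m) % m ≡ suc a % m
  suc-%-% a = %-cong-+ {1} refl (m%n%n≡m%n a m)

  toℕ-inc-% : (x : Fin m) → toℕ (inc x) % m ≡ suc (toℕ x) % m
  toℕ-inc-% x = trans (cong (_% m) (toℕ-fromℕ< _)) (m%n%n≡m%n (suc (toℕ x)) m)

  S<m : (v : V m) → S v < m
  S<m (i , j , k) = m%n<n (toℕ i + toℕ j + toℕ k) m

  S-shift : ∀ d (v : V m) → S (shift d v) ≡ suc (S v) % m
  S-shift d v@(i , j , k) = trans (shifted-sum d) (sym (suc-%-% (toℕ i + toℕ j + toℕ k)))
    where
    shifted-sum : ∀ d → S (shift d v) ≡ suc (toℕ i + toℕ j + toℕ k) % m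
    shifted-sum Fin.zero =
      %-cong-+ (%-cong-+ (toℕ-inc-% i) refl) refl
    shifted-sum (Fin.suc Fin.zero) =
      trans (%-cong-+ (%-cong-+ {toℕ i} refl (toℕ-inc-% j)) refl)
            (cong (λ t → (t + toℕ k) % m) (+-suc (toℕ i) (toℕ j)))
    shifted-sum (Fin.suc (Fin.suc Fin.zero)) =
      trans (%-cong-+ {toℕ i + toℕ j} refl (toℕ-inc-% k))
            (cong (_% m) (+-suc (toℕ i + toℕ j) (toℕ k)))

  S-col : (C : Coloring m) (c : Fin 3) (v : V m) → S (col C c v) ≡ suc (S v) % m
  S-col C c v with proj₁ (Coloring.arcs C v) c
  ... | d , f-arc = trans (cong S f-arc) (S-shift d v)

  col-injective : (C : Coloring m) (c : Fin 3) → Injective _≡_ _≡_ (col C c)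
  col-injective C c = Injection.injective (↔⇒↣ (Coloring.f C c))

module FirstReturn {A : Set} {m : ℕ} .{{_ : NonZero m}}
  (g : A → A) (layer : A → ℕ)
  (layer<m : ∀ x → layer x < m) (layer-g : ∀ x → layer (g x) ≡ suc (layer x) % m)
  where

  Layer₀ : Set
  Layer₀ = Σ A λ x → layer x ≡ 0

  Layer₀-≡ : {p q : Layer₀} → proj₁ p ≡ proj₁ q → p ≡ q
  Layer₀-≡ {x , s} {.x , t} refl = cong (x ,_) (≡-irrelevant s t)

  layer-iter : ∀ k x → layer (iter k g x) ≡ (k + layer x) % m
  layer-iter zero    x = sym (m<n⇒m%n≡m (layer<m x))
  layer-iter (suc k) x = begin
    layer (g (iter k g x))       ≡⟨ layer-g (iter k g x) ⟩
    suc (layer (iter k g x)) % m ≡⟨ cong (λ t → suc t % m) (layer-iter k x) ⟩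
    suc ((k + layer x) % m) % m  ≡⟨ suc-%-% (k + layer x) ⟩
    suc (k + layer x) % m        ∎

  reaches-Layer₀ : ∀ x → ∃ λ (p : Layer₀) → SameCycle g x (proj₁ p)
  reaches-Layer₀ x = (iter (m ∸ layer x) g x , lands) , m ∸ layer x , refl
    where
    lands : layer (iter (m ∸ layer x) g x) ≡ 0
    lands = begin
      layer (iter (m ∸ layer x) g x) ≡⟨ layer-iter (m ∸ layer x) x ⟩
      (m ∸ layer x + layer x) % m    ≡⟨ cong (_% m) (m∸n+n≡m (<⇒≤ (layer<m x))) ⟩
      m % m                          ≡⟨ n%n≡0 m ⟩
      0                              ∎

  m∣Layer₀-returnTime : ∀ (p q : Layer₀) k → iter k g (proj₁ p) ≡ proj₁ q → m ∣ k
  m∣Layer₀-returnTime (x , x₀) q k reach = m%n≡0⇒n∣m k m (begin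
    k % m              ≡⟨ cong (_% m) (+-identityʳ k) ⟨
    (k + 0) % m        ≡⟨ cong (λ t → (k + t) % m) x₀ ⟨
    (k + layer x) % m  ≡⟨ layer-iter k x ⟨
    layer (iter k g x) ≡⟨ cong layer reach ⟩
    layer (proj₁ q)    ≡⟨ proj₂ q ⟩
    0                  ∎)

  module ReturnMap (F : Layer₀ → Layer₀) (F-underlying : ∀ p → proj₁ (F p) ≡ iter m g (proj₁ p)) where

    iter-F : ∀ n p → proj₁ (iter n F p) ≡ iter (m * n) g (proj₁ p)
    iter-F n p = trans (iter-semiconj proj₁ F-underlying n p) (sym (iter-* g m n (proj₁ p)))

    Layer₀-return : ∀ p q k → iter k g (proj₁ p) ≡ proj₁ q → ∃ λ n → k ≡ m * n × iter n F p ≡ q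
    Layer₀-return p q k reach with m∣Layer₀-returnTime p q k reach
    ... | divides n k≡n*m = n , k≡m*n , Layer₀-≡ (begin
      proj₁ (iter n F p)       ≡⟨ iter-F n p ⟩
      iter (m * n) g (proj₁ p) ≡⟨ cong (λ t → iter t g (proj₁ p)) k≡m*n ⟨
      iter k g (proj₁ p)       ≡⟨ reach ⟩
      proj₁ q                  ∎)
      where
      k≡m*n : k ≡ m * n
      k≡m*n = trans k≡n*m (*-comm n m)

    sameCycle⇔ : ∀ p q → SameCycle g (proj₁ p) (proj₁ q) ⇔ SameCycle F p q
    sameCycle⇔ p q = mk⇔ (λ (k , reach) → let (n , _ , F-reach) = Layer₀-return p q k reach in n , F-reach)
                         (λ (n , F-reach) → m * n , trans (sym (iter-F n p)) (cong proj₁ F-reach))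

    cycleLength-lift : ∀ p L → CycleLength F p L → CycleLength g (proj₁ p) (m * L)
    cycleLength-lift p L (L>0 , period , minimal) =
      m<n⇒m<o*n m L>0 , trans (sym (iter-F L p)) (cong proj₁ period) , minimal′
      where
      minimal′ : ∀ k → 0 < k → k < m * L → iter k g (proj₁ p) ≢ proj₁ p
      minimal′ k k>0 k<mL returns with Layer₀-return p p k returns
      ... | n , refl , F-returns = minimal n (m*n>0⇒n>0 m k>0) (*-cancelˡ-< m n L k<mL) F-returns

    cycleLength-lower : ∀ p L → CycleLength g (proj₁ p) (m * L) → CycleLength F p L
    cycleLength-lower p L (mL>0 , period , minimal) =
        m*n>0⇒n>0 m mL>0
      , Layer₀-≡ (trans (iter-F L p) period)
      , λ k k>0 k<L returns →
          minimal (m * k) (m<n⇒m<o*n m k>0) (*-monoʳ-< m k<L) (trans (sym (iter-F k p)) (cong proj₁ returns))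

    singleCycle⇔ : Injective _≡_ _≡_ g → ∀ N → SingleCycle g (m * N) ⇔ SingleCycle F N
    singleCycle⇔ g-injective N = mk⇔ lower lift
      where
      lower : SingleCycle g (m * N) → SingleCycle F N
      lower (connected , lengths) =
          (λ p q → Equivalence.to (sameCycle⇔ p q) (connected (proj₁ p) (proj₁ q)))
        , λ p → cycleLength-lower p N (lengths (proj₁ p))

      lift : SingleCycle F N → SingleCycle g (m * N)
      lift (connected , lengths) = connected′ , lengths′
        where
        lengths′ : ∀ x → CycleLength g x (m * N)
        lengths′ x with reaches-Layer₀ x
        ... | p , j , refl = CycleLength-fromOrbit g g-injective j (cycleLength-lift p N (lengths p))

        connected′ : ∀ x y → SameCycle g x y
        connected′ x y with reaches-Layer₀ x | reaches-Layer₀ y | lengths′ y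
        ... | p , x→p | q@(_ , _) , j , refl | mN>0 , period , _ =
          SameCycle-trans g x→p
            (SameCycle-trans g (Equivalence.from (sameCycle⇔ p q) (connected p q))
              (SameCycle-return g (m * N) mN>0 period j))

lemma2p9 : (m : ℕ) .{{_ : NonZero m}} → 3 ≤ m → (C : Coloring m) (c : Fin 3) →
    -- every directed cycle of f_c meets P_0 (so C ↦ C ∩ P_0 hits every cycle)
    (∀ (v : V m) → ∃ λ (p : P0 m) → SameCycle (col C c) v (proj₁ p))
    -- points of P_0 share an f_c-cycle iff they share an F_c-cycle (C ∩ P_0 is exactly one F_c-cycle; bijection)
    × (∀ (p q : P0 m) → SameCycle (col C c) (proj₁ p) (proj₁ q) ⇔ SameCycle (Fmap C c) p q)
    -- length of the f_c-cycle = m * length of the corresponding F_c-cycle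
    × (∀ (p : P0 m) (L : ℕ) → CycleLength (Fmap C c) p L → CycleLength (col C c) (proj₁ p) (m * L))
    -- in particular: single cycle of length m^3 iff F_c single cycle of length m^2
    × (SingleCycle (col C c) (m ^ 3) ⇔ SingleCycle (Fmap C c) (m ^ 2))
lemma2p9 m _ C c =
  reaches-Layer₀ , sameCycle⇔ , cycleLength-lift , singleCycle⇔ (col-injective C c) (m ^ 2)
  where
  open FirstReturn (col C c) S S<m (S-col C c)
  open ReturnMap (Fmap C c) (λ _ → refl)
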